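{- Let $(\mathcal{R},W)$ be a Strip Packing instance, run the Bottom-Left algorithm with the $\mathcal{FQW}$-ordering, and assume $\mathcal{Q}\neq\emptyset$ and $\max\{y_r+h_r:r\in\mathcal{Q}\}>h_{\max}$. Let $\ell$ and $\ell'$ be proper horizontal lines with $\ell$ below $\ell'$. Let $r\in\mathcal{Q}$ with $r\in T(\ell)$ and let $r'\in\mathcal{Q}$ with $r'\in T(\ell')$ and $r'\notin T(\ell)$. Then $w_r\ge w_{r'}$.
   Context: Strip Packing: an instance $(\mathcal{R},W)$ consists of a strip $[0,W]\times[0,\infty)$ with $W>0$ and a finite set $\mathcal{R}$ of $n$ axis-parallel closed rectangles; rectangle $r$ has width $w_r\in(0,W]$ and height $h_r>0$; $h_{\max}=\max_r h_r$. A packing assigns to each $r$ a lower-left corner $(x_r,y_r)$; it is feasible if $x_r\ge0$, $x_r+w_r\le W$, $y_r\ge0$ and the open rectangles $(x_r,x_r+w_r)\times(y_r,y_r+h_r)$ are pairwise disjoint; no rotations. Bottom-Left (BL) algorithm: given an ordering $r_1,\dots,r_n$, place $r_1$ at $(0,0)$; for $i\ge2$ choose $(x_{r_i},y_{r_i})$ such that $r_1,\dots,r_i$ form a feasible packing and $(y_{r_i},x_{r_i})$ is lexicographically minimal. $\mathcal{FQW}$-partition: go through the rectangles in order of non-increasing height (ties arbitrary), adding $r$ to $\mathcal{F}$ (initially empty) iff $w_r+\sum_{f\in\mathcal{F}}w_f\le W$; $\mathcal{W}=\{r\in\mathcal{R}\setminus\mathcal{F}:w_r>W/2\}$, $\mathcal{Q}=\mathcal{R}\setminus(\mathcal{F}\cup\mathcal{W})$.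 The $\mathcal{FQW}$-ordering lists $\mathcal{F}$ by non-increasing height, then $\mathcal{Q}$ by non-increasing width, then $\mathcal{W}$ in any order; ties arbitrary. A horizontal line $\{(x,c):0\le x\le W\}$ is proper if $c\notin\{y_r,y_r+h_r:r\in\mathcal{R}\}$. A rectangle $r$ is above the line if $y_r>c$. The type $T(\ell)$ of a proper line $\ell$ is the set of rectangles of $\mathcal{Q}$ that intersect $\ell$ and are placed before the first rectangle (in the ordering) that lies above $\ell$.
   Formalization: The strip width W, the rectangle widths and heights, the corner coordinates, the positions compared in Bottom-Left's lexicographic minimality, and the heights of the lines ℓ and ℓ' are all rational. -}

module Defs where

open import Data.Nat as ℕ using (ℕ)
open import Data.Fin using (Fin; toℕ)
open import Data.Rational using (ℚ; 0ℚ; ½; _+_; _*_; _≤_; _<_)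
open import Data.Rational.Properties using (_≤?_)
open import Data.List using (List; []; _∷_)
open import Data.List.Membership.Propositional using (_∈_)
open import Data.Product using (Σ; ∃; _×_; _,_)
open import Data.Sum using (_⊎_)
open import Relation.Nullary using (¬_; yes; no)
open import Relation.Binary.PropositionalEquality using (_≡_; _≢_)

-- A Strip Packing instance with n rectangles.  Rectangles are indexed by
-- Fin n, and the index order IS the ordering fed to Bottom-Left
-- (rectangle i is r_{i+1}).  Numbers are rationals.
record Instance (n : ℕ) : Set where
  field
    W     : ℚ
    w     : Fin n → ℚ
    h     : Fin n → ℚ
    W-pos : 0ℚ < W
    w-pos : ∀ i → 0ℚ < w i
    w≤W   : ∀ i → w i ≤ W
    h-pos : ∀ i → 0ℚ < h i
open Instance public

-- A placement: lower-left corners.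
record Placement (n : ℕ) : Set where
  field
    x : Fin n → ℚ
    y : Fin n → ℚ
open Placement public

module _ {n : ℕ} (I : Instance n) where

  Disjoint : Fin n → ℚ → ℚ → Fin n → ℚ → ℚ → Set
  Disjoint i a b j a' b' =
    (a + w I i ≤ a') ⊎ (a' + w I j ≤ a) ⊎ (b + h I i ≤ b') ⊎ (b' + h I j ≤ b)

  Fits : Placement n → Fin n → ℚ → ℚ → Set
  Fits P i a b =
    (0ℚ ≤ a) × (a + w I i ≤ W I) × (0ℚ ≤ b) ×
    (∀ j → toℕ j ℕ.< toℕ i → Disjoint i a b j (x P j) (y P j))

  -- P is the output of Bottom-Left for the ordering given by the indices:
  -- every rectangle is placed at a feasible position whose (y,x) is
  -- lexicographically minimal among all feasible positions.
  -- (For the first rectangle this forces (0,0).)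
  IsBL : Placement n → Set
  IsBL P = ∀ i → Fits P i (x P i) (y P i) ×
    (∀ a b → Fits P i a b → (y P i < b) ⊎ ((y P i ≡ b) × (x P i ≤ a)))

  greedyF : ℚ → List (Fin n) → List (Fin n)
  greedyF acc [] = []
  greedyF acc (r ∷ rs) with acc + w I r ≤? W I
  ... | yes _ = r ∷ greedyF (acc + w I r) rs
  ... | no  _ = greedyF acc rs

  -- L is a list of all rectangles in non-increasing height (ties arbitrary);
  -- the FQW-partition determined by L:
  InF : List (Fin n) → Fin n → Set
  InF L i = i ∈ greedyF 0ℚ L

  InW : List (Fin n) → Fin n → Set
  InW L i = ¬ InF L i × (½ * W I < w I i)

  InQ : List (Fin n) → Fin n → Set
  InQ L i = ¬ InF L i × ¬ (½ * W I < w I i)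

  IsFQWOrdering : List (Fin n) → Set
  IsFQWOrdering L = ∀ i j → toℕ i ℕ.< toℕ j →
    (InF L j → InF L i) ×
    (InQ L j → InF L i ⊎ InQ L i) ×
    (InF L i → InF L j → h I j ≤ h I i) ×
    (InQ L i → InQ L j → w I j ≤ w I i)

  Proper : Placement n → ℚ → Set
  Proper P c = ∀ i → (c ≢ y P i) × (c ≢ y P i + h I i)

  Intersects : Placement n → ℚ → Fin n → Set
  Intersects P c i = (y P i ≤ c) × (c ≤ y P i + h I i)

  Above : Placement n → ℚ → Fin n → Set
  Above P c i = c < y P i

  -- i ∈ T(ℓ) for the line ℓ at height c: i ∈ Q, i intersects ℓ, and i is
  -- placed before the first rectangle lying above ℓ, i.e. no rectangle
  -- placed before or at i lies above ℓ (vacuous if none lies above).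
  InType : List (Fin n) → Placement n → ℚ → Fin n → Set
  InType L P c i = InQ L i × Intersects P c i ×
    (∀ j → toℕ j ℕ.≤ toℕ i → ¬ Above P c j)

{-# OPTIONS --safe #-}
-- If r is placed before r', both lie in Q, which the FQW-ordering sorts by
-- non-increasing width.  Otherwise r' is placed no later than r, so nothing
-- placed up to r' lies above ℓ; in particular r' does not start above ℓ, and
-- it reaches ℓ' and hence ℓ, so r' would cross ℓ and belong to T(ℓ).
module Submission where

open import Defs
open import Data.Empty using (⊥-elim)
open import Data.Nat using (ℕ)
open import Data.Fin using (Fin; toℕ)
open import Data.Rational using (ℚ; _+_; _≤_; _<_)
open import Data.List using (List; allFin)
open import Data.List.Relation.Unary.Linked using (Linked)
open import Data.List.Relation.Binary.Permutation.Propositional using (_↭_)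
open import Data.Product using (Σ; _×_; _,_)
open import Relation.Nullary using (¬_; yes; no)
import Data.Nat as ℕ
import Data.Nat.Properties as ℕ
import Data.Rational.Properties as ℚ

module _ {n : ℕ} (I : Instance n) (L : List (Fin n)) where

  IsFQWOrdering⇒Q-width-antitone : IsFQWOrdering I L → ∀ {i j} →
    toℕ i ℕ.< toℕ j → InQ I L i → InQ I L j → w I j ≤ w I i
  IsFQWOrdering⇒Q-width-antitone fqw {i} {j} i<j with fqw i j i<j
  ... | _ , _ , _ , Q-width = Q-width

  InType-earlier : ∀ (P : Placement n) {c r r'} → InType I L P c r →
    toℕ r' ℕ.≤ toℕ r → InQ I L r' → c ≤ y P r' + h I r' → InType I L P c r'
  InType-earlier P {r' = r'} (_ , _ , noneAbove) r'≤r r'∈Q c≤top =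
    r'∈Q , (ℚ.≮⇒≥ (noneAbove r' r'≤r) , c≤top) ,
    λ j j≤r' → noneAbove j (ℕ.≤-trans j≤r' r'≤r)

lemma12 : ∀ {n} (I : Instance n) (P : Placement n) (L : List (Fin n))
    → L ↭ allFin n
    → Linked (λ a b → h I b ≤ h I a) L
    → IsFQWOrdering I L
    → IsBL I P
    → Σ (Fin n) (λ q → InQ I L q)
    → Σ (Fin n) (λ q → InQ I L q × (∀ j → h I j < y P q + h I q))
    → (c c' : ℚ) → Proper I P c → Proper I P c' → c < c'
    → (r r' : Fin n)
    → InType I L P c r
    → InType I L P c' r'
    → ¬ InType I L P c r'
    → w I r' ≤ w I r
lemma12 I P L _ _ fqw _ _ _ c c' _ _ c<c' r r' r∈T@(r∈Q , _) (r'∈Q , (_ , c'≤top) , _) r'∉T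
  with toℕ r ℕ.<? toℕ r'
... | yes r<r' = IsFQWOrdering⇒Q-width-antitone I L fqw r<r' r∈Q r'∈Q
... | no r≮r' = ⊥-elim (r'∉T (InType-earlier I L P r∈T (ℕ.≮⇒≥ r≮r') r'∈Q c≤top))
  where
  c≤top : c ≤ y P r' + h I r'
  c≤top = ℚ.≤-trans (ℚ.<⇒≤ c<c') c'≤top
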